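{- Let $\rho$ be a $\mathsf{Clo}$ derivation obtained from an $\mathsf{NW}$ proof $\pi$ of $\Phi=\{\nu x.\phi,\nu y.\psi\}$. Let $u$ and $v$ be unfolding nodes of $\rho$ such that $v$ is a child of $u$ in $\mathcal T_\rho$ and $v$ is an $x$-node. Let $u'$ be a node between $u$ and $v$ in $\rho$ labelled by a rule $\mathsf{Clo}_{\mathfrak y}$ with principal formula $\nu y.\psi$. Then none of the discharged assumptions of this rule instance lie in the subtree of $\rho$ rooted at $v$. The same holds if instead $v$ is a $y$-node and the principal formula of the $\mathsf{Clo}$ rule at $u'$ is $\nu x.\phi$.
   Context: Modal $\mu$-calculus formulas: $\phi ::= p \mid \bar p \mid x \mid \phi\lor\phi \mid \phi\land\phi \mid \Diamond\phi \mid \Box\phi \mid \mu x.\phi \mid \nu x.\phi$; sequents are finite sets of closed, clean formulas; subsumption order $x\le y$ iff $x$ occurs free in $\eta y.\psi$; $\phi[\eta x.\phi]$ is the unfolding; $\Diamond\Gamma=\{\Diamond\chi:\chi\in\Gamma\}$. $\mathsf{NW}$: rules Ax: $p,\bar p$; $\lor$: $\Gamma,\phi,\psi$ / $\Gamma,\phi\lor\psi$; $\land$: $\Gamma,\phi$ and $\Gamma,\psi$ / $\Gamma,\phi\land\psi$; weakening: $\Gamma$ / $\Gamma,\phi$; $\Box$: $\Gamma,\phi$ / $\Diamond\Gamma,\Box\phi$; $\eta$: $\Gamma,\phi[\eta x.\phi]$ / $\Gamma,\eta x.\phi$. Derivations are possibly infinite trees with all leaves Ax. Descendants as usual (side formulas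 to themselves, principal formula to the formulas it produces in the premise, weakened formulas have none); a trace along a path is a sequence of formulas each a descendant of the previous; an infinite trace is a $\nu$-trace if the subsumption-minimal fixpoint formula occurring infinitely often is a $\nu$-formula. An $\mathsf{NW}$ proof is a derivation with a $\nu$-trace on every infinite branch. $\mathsf{Clo}$: disjoint infinite name sets $N_x$ per formal variable, $N=\bigcup N_x$; $\mathfrak y\in N_y$ satisfies $\mathfrak y\le x$ iff $y\le x$, and $a\in N^*$ satisfies $a\le x$ iff all its names do; $\sqsubseteq$ is the reflexive sub-word relation. Annotated formulas $\phi^a$, $a\in N^*$. Rules: Ax: $p^\epsilon,\bar p^\epsilon$; $\lor,\land$, weakening, $\Box$ as in $\mathsf{NW}$ with a common annotation $a$ on the principal formula and its components (side formulas keep annotations); $\eta$: $\Gamma,\phi[\eta x.\phi]^a$ / $\Gamma,\eta x.\phi^a$ if $a\le x$; Exp: $\phi_1^{a_1},\dots,\phi_n^{a_n}$ / $\phi_1^{b_1},\dots,\phi_n^{b_n}$ if $a_i\sqsubseteq b_i$; $\mathsf{Clo}_{\mathfrak x}$: $\Gamma,\phi[\nu x.\phi]^{a\mathfrak x}$ / $\Gamma,\nu x.\phi^a$, where $a\le\mathfrak x$, $\mathfrak x\in N_x$ does not occur in $\Gamma$; leaves above it labelled $\Gamma,\nu x.\phi^{a\mathfrak x}$ may be marked $\mathfrak x$ (discharged assumptions of this rule instance). A $\mathsf{Clo}$ derivation is a (possibly infinite) tree of these rules whose leaves are Ax or discharged assumptions whose companion is an ancestor, each $\mathsf{Clo}$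 instance with a unique token. A $\mathsf{Clo}$ derivation $\rho$ of $\Gamma$ is obtained from an $\mathsf{NW}$ proof $\pi$ of $\Gamma$ if $\pi$ can be turned into $\rho$ by (1) changing some $\nu$ rule instances into $\mathsf{Clo}$ rule instances with discharged assumptions, pruning the tree at the discharged assumptions, and (2) adding annotations and Exp rules accordingly. Let $\nu x.\phi \equiv \nu x.\Diamond(\bar p\land(\Box x\lor\Diamond\nu y.\Box(p\land(\Box x\lor\Diamond y))))$, $\nu y.\psi\equiv \nu y.\Box(p\land(\Box\nu x.\phi\lor\Diamond y))$, $\Phi=\{\nu x.\phi,\nu y.\psi\}$. In a $\mathsf{Clo}$ derivation $\rho$ of $\Phi$, an unfolding node is a node labelled by the sequent $\Phi$ (with some annotations) that is not an Exp node. The unfolding tree $\mathcal T_\rho$ has the unfolding nodes as vertices, $v$ being a child of $u$ iff $v$ is above $u$ in $\rho$ with no other unfolding node strictly between. For an unfolding node $v$ with parent $u$ in $\mathcal T_\rho$: $v$ is an $x$-node if there is no trace from $\nu y.\psi$ at $u$ to $\nu x.\phi$ or $\nu y.\psi$ at $v$; $v$ is a $y$-node if there is no trace from $\nu x.\phi$ at $u$ to $\nu x.\phi$ or $\nu y.\psi$ at $v$. -}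

module Defs where

open import Data.Nat using (ℕ; zero; suc; _≤_; _+_)
open import Data.Nat.Properties using (_≟_)
open import Data.Bool using (Bool; true; false)
open import Data.List using (List; []; _∷_; _++_; map; [_])
open import Data.List.Membership.Propositional using (_∈_; _∉_)
open import Data.List.Relation.Unary.All using (All)
open import Data.List.Relation.Binary.Subset.Propositional using () renaming (_⊆_ to _⊆ˢ_)
open import Data.List.Relation.Binary.Sublist.Propositional using () renaming (_⊆_ to _⊑_)
open import Data.Maybe using (Maybe; just; nothing)
open import Data.Product using (Σ; ∃; ∃-syntax; _×_; _,_; proj₁; proj₂)
open import Data.Sum using (_⊎_)
open import Data.Unit using (⊤; tt)
open import Data.Empty using (⊥)
open import Relation.Nullary using (¬_; yes; no)
open import Relation.Binary.PropositionalEquality using (_≡_; _≢_)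

Var : Set
Var = ℕ

Prop : Set
Prop = ℕ

data FixKind : Set where
  μK νK : FixKind

data Fm : Set where
  pos neg : Prop → Fm
  var     : Var → Fm
  _∨ᶠ_ _∧ᶠ_ : Fm → Fm → Fm
  ◇ □     : Fm → Fm
  fix     : FixKind → Var → Fm → Fm

-- substitution φ[t/x] (t closed, formulas clean)
_[_≔_] : Fm → Var → Fm → Fm
pos p [ x ≔ t ] = pos p
neg p [ x ≔ t ] = neg p
var z [ x ≔ t ] with z ≟ x
... | yes _ = t
... | no _  = var z
(φ ∨ᶠ ψ) [ x ≔ t ] = (φ [ x ≔ t ]) ∨ᶠ (ψ [ x ≔ t ])
(φ ∧ᶠ ψ) [ x ≔ t ] = (φ [ x ≔ t ]) ∧ᶠ (ψ [ x ≔ t ])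
◇ φ [ x ≔ t ] = ◇ (φ [ x ≔ t ])
□ φ [ x ≔ t ] = □ (φ [ x ≔ t ])
fix k z φ [ x ≔ t ] with z ≟ x
... | yes _ = fix k z φ
... | no _  = fix k z (φ [ x ≔ t ])

unfold : FixKind → Var → Fm → Fm
unfold k x φ = φ [ x ≔ fix k x φ ]

data FreeIn (x : Var) : Fm → Set where
  var  : FreeIn x (var x)
  orl  : ∀ {φ ψ} → FreeIn x φ → FreeIn x (φ ∨ᶠ ψ)
  orr  : ∀ {φ ψ} → FreeIn x ψ → FreeIn x (φ ∨ᶠ ψ)
  andl : ∀ {φ ψ} → FreeIn x φ → FreeIn x (φ ∧ᶠ ψ)
  andr : ∀ {φ ψ} → FreeIn x ψ → FreeIn x (φ ∧ᶠ ψ)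
  dia  : ∀ {φ} → FreeIn x φ → FreeIn x (◇ φ)
  box  : ∀ {φ} → FreeIn x φ → FreeIn x (□ φ)
  fix  : ∀ {k z φ} → z ≢ x → FreeIn x φ → FreeIn x (fix k z φ)

data Sub (χ : Fm) : Fm → Set where
  here : Sub χ χ
  orl  : ∀ {φ ψ} → Sub χ φ → Sub χ (φ ∨ᶠ ψ)
  orr  : ∀ {φ ψ} → Sub χ ψ → Sub χ (φ ∨ᶠ ψ)
  andl : ∀ {φ ψ} → Sub χ φ → Sub χ (φ ∧ᶠ ψ)
  andr : ∀ {φ ψ} → Sub χ ψ → Sub χ (φ ∧ᶠ ψ)
  dia  : ∀ {φ} → Sub χ φ → Sub χ (◇ φ)
  box  : ∀ {φ} → Sub χ φ → Sub χ (□ φ)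
  fix  : ∀ {k z φ} → Sub χ φ → Sub χ (fix k z φ)

-- Subsumption order on formal variables, relative to the (clean) end sequent Φ0:
-- x ≤ y iff x = y or x occurs free in the binding formula ηy.ψ of y
-- (a subformula of a formula of Φ0).
VarLe : List Fm → Var → Var → Set
VarLe Φ0 x y = x ≡ y ⊎ (∃[ φ0 ] ∃[ k ] ∃[ χ ]
  (φ0 ∈ Φ0 × Sub (fix k y χ) φ0 × FreeIn x (fix k y χ)))

fixOf : Fm → Maybe (FixKind × Var)
fixOf (fix k x _) = just (k , x)
fixOf _ = nothing

-- Sequents are finite sets, represented by lists up to set equality

_≋_ : {A : Set} → List A → List A → Set
xs ≋ ys = (xs ⊆ˢ ys) × (ys ⊆ˢ xs)

-- labelled formulas (label = annotation; ⊤ for unannotated NW)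
LF : Set → Set
LF L = Fm × L

data BaseR (L : Set) : Set where
  ax   : Prop → L → BaseR L
  or   : List (LF L) → Fm → Fm → L → BaseR L
  and  : List (LF L) → Fm → Fm → L → BaseR L
  weak : List (LF L) → Fm → L → BaseR L
  box  : List (LF L) → Fm → L → BaseR L
  fixR : List (LF L) → FixKind → Var → Fm → L → BaseR L

diaL : {L : Set} → LF L → LF L
diaL (χ , b) = (◇ χ , b)

concB : {L : Set} → BaseR L → List (LF L)
concB (ax p l) = (pos p , l) ∷ (neg p , l) ∷ []
concB (or Γ φ ψ l) = (φ ∨ᶠ ψ , l) ∷ Γ
concB (and Γ φ ψ l) = (φ ∧ᶠ ψ , l) ∷ Γ
concB (weak Γ φ l) = (φ , l) ∷ Γ
concB (box Γ φ l) = (□ φ , l) ∷ map diaL Γ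
concB (fixR Γ k x φ l) = (fix k x φ , l) ∷ Γ

-- premise number 'false' is the first/left premise, 'true' the second/right one
premB : {L : Set} → BaseR L → Bool → Maybe (List (LF L))
premB (ax p l) _ = nothing
premB (or Γ φ ψ l) false = just ((φ , l) ∷ (ψ , l) ∷ Γ)
premB (or Γ φ ψ l) true = nothing
premB (and Γ φ ψ l) false = just ((φ , l) ∷ Γ)
premB (and Γ φ ψ l) true = just ((ψ , l) ∷ Γ)
premB (weak Γ φ l) false = just Γ
premB (weak Γ φ l) true = nothing
premB (box Γ φ l) false = just ((φ , l) ∷ Γ)
premB (box Γ φ l) true = nothing
premB (fixR Γ k x φ l) false = just ((unfold k x φ , l) ∷ Γ)
premB (fixR Γ k x φ l) true = nothing

Side : {L : Set} → List (LF L) → LF L → LF L → Set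
Side Γ θ θ' = θ ∈ Γ × θ' ≡ θ

-- descB r b θ θ' : θ' (in premise b) is a descendant of θ (in the conclusion)
descB : {L : Set} → BaseR L → Bool → LF L → LF L → Set
descB (ax p l) _ θ θ' = ⊥
descB (or Γ φ ψ l) _ θ θ' = Side Γ θ θ' ⊎
  (θ ≡ (φ ∨ᶠ ψ , l) × (θ' ≡ (φ , l) ⊎ θ' ≡ (ψ , l)))
descB (and Γ φ ψ l) false θ θ' = Side Γ θ θ' ⊎ (θ ≡ (φ ∧ᶠ ψ , l) × θ' ≡ (φ , l))
descB (and Γ φ ψ l) true θ θ' = Side Γ θ θ' ⊎ (θ ≡ (φ ∧ᶠ ψ , l) × θ' ≡ (ψ , l))
descB (weak Γ φ l) _ θ θ' = Side Γ θ θ'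
descB (box Γ φ l) _ θ θ' = (θ ≡ (□ φ , l) × θ' ≡ (φ , l)) ⊎ (θ' ∈ Γ × θ ≡ diaL θ')
descB (fixR Γ k x φ l) _ θ θ' = Side Γ θ θ' ⊎
  (θ ≡ (fix k x φ , l) × θ' ≡ (unfold k x φ , l))

-- Generic (possibly infinite) trees of rule instances.
-- A tree is a partial map from addresses (root-first lists of premise
-- choices) to rule instances.

Addr : Set
Addr = List Bool

module Trees {I F : Set} (conc : I → List F) (prem : I → Bool → Maybe (List F))
             (desc : I → Bool → F → F → Set) where

  Tree : Set
  Tree = Addr → Maybe I

  data ChildOK : Maybe I → Bool → Maybe I → Set where
    none₁ : ∀ {b} → ChildOK nothing b nothing
    none₂ : ∀ {r b} → prem r b ≡ nothing → ChildOK (just r) b nothing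
    some  : ∀ {r b Δ r'} → prem r b ≡ just Δ → conc r' ≋ Δ → ChildOK (just r) b (just r')

  WellFormed : Tree → List F → Set
  WellFormed t Γ = (∃[ r ] (t [] ≡ just r × conc r ≋ Γ))
                 × (∀ α b → ChildOK (t α) b (t (α ++ [ b ])))

  data TraceFrom (t : Tree) : Addr → F → List Bool → F → Set where
    here : ∀ {α θ r} → t α ≡ just r → θ ∈ conc r → TraceFrom t α θ [] θ
    step : ∀ {α θ θ' θ'' r b γ} → t α ≡ just r → θ ∈ conc r → desc r b θ θ' →
           TraceFrom t (α ++ [ b ]) θ' γ θ'' → TraceFrom t α θ (b ∷ γ) θ''

  pre : (ℕ → Bool) → ℕ → Addr
  pre β zero = []
  pre β (suc n) = pre β n ++ [ β n ]

  InfBranch : Tree → (ℕ → Bool) → Set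
  InfBranch t β = ∀ n → ∃[ r ] (t (pre β n) ≡ just r)

  InfTrace : Tree → (ℕ → Bool) → ℕ → (ℕ → F) → Set
  InfTrace t β k θ = ∀ i → ∃[ r ] (t (pre β (k + i)) ≡ just r × θ i ∈ conc r
                                   × desc r (β (k + i)) (θ i) (θ (suc i)))

  StrictPre : Addr → Addr → Set
  StrictPre α β = ∃[ δ ] (δ ≢ [] × α ++ δ ≡ β)

NWR : Set
NWR = BaseR ⊤

module NW = Trees {NWR} {LF ⊤} concB premB descB

InfOften : (ℕ → LF ⊤) → Maybe (FixKind × Var) → Set
InfOften θ m = ∀ n → ∃[ n' ] (n ≤ n' × fixOf (proj₁ (θ n')) ≡ m)

NuTrace : List Fm → (ℕ → LF ⊤) → Set
NuTrace Φ0 θ = ∃[ z ] (InfOften θ (just (νK , z)) ×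
  (∀ k w → InfOften θ (just (k , w)) → VarLe Φ0 z w))

-- NW proof of Γ (infinite trees; all leaves are Ax since Ax is the only
-- premise-free NW rule)
NWProof : NW.Tree → List Fm → Set
NWProof π Γ = NW.WellFormed π (map (λ φ → (φ , tt)) Γ)
  × (∀ β → NW.InfBranch π β → ∃[ k ] ∃[ θ ] (NW.InfTrace π β k θ × NuTrace Γ θ))

-- names: N_x = {x} × ℕ
Name : Set
Name = Var × ℕ

Ann : Set
Ann = List Name

AF : Set
AF = LF Ann

data CloR : Set where
  base  : BaseR Ann → CloR
  exp   : List (Fm × Ann × Ann) → CloR    -- (φ_i , a_i , b_i): premise φ_i^{a_i}, conclusion φ_i^{b_i}
  clo   : List AF → Var → Fm → Ann → Name → CloR
  disch : List AF → Var → Fm → Ann → Name → CloR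

concC : CloR → List AF
concC (base r) = concB r
concC (exp ts) = map (λ { (φ , a , b) → (φ , b) }) ts
concC (clo Γ x φ a n) = (fix νK x φ , a) ∷ Γ
concC (disch Γ x φ a n) = (fix νK x φ , a ++ [ n ]) ∷ Γ

premC : CloR → Bool → Maybe (List AF)
premC (base r) b = premB r b
premC (exp ts) false = just (map (λ { (φ , a , b) → (φ , a) }) ts)
premC (exp ts) true = nothing
premC (clo Γ x φ a n) false = just ((unfold νK x φ , a ++ [ n ]) ∷ Γ)
premC (clo Γ x φ a n) true = nothing
premC (disch Γ x φ a n) _ = nothing

descC : CloR → Bool → AF → AF → Set
descC (base r) b θ θ' = descB r b θ θ'
descC (exp ts) _ θ θ' = ∃[ φ ] ∃[ a ] ∃[ b ] ((φ , a , b) ∈ ts × θ ≡ (φ , b) × θ' ≡ (φ , a))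
descC (clo Γ x φ a n) _ θ θ' = Side Γ θ θ' ⊎
  (θ ≡ (fix νK x φ , a) × θ' ≡ (unfold νK x φ , a ++ [ n ]))
descC (disch Γ x φ a n) _ θ θ' = ⊥

module Clo = Trees {CloR} {AF} concC premC descC

-- a ≤ x : all names of a are ≤ x  (𝔶 ∈ N_y is ≤ x iff y ≤ x)
AnnLe : List Fm → Ann → Var → Set
AnnLe Φ0 a x = All (λ n → VarLe Φ0 (proj₁ n) x) a

CloValid : List Fm → CloR → Set
CloValid Φ0 (base (ax p a)) = a ≡ []
CloValid Φ0 (base (fixR Γ k x φ a)) = AnnLe Φ0 a x
CloValid Φ0 (base _) = ⊤
CloValid Φ0 (exp ts) = All (λ { (φ , a , b) → a ⊑ b }) ts
CloValid Φ0 (clo Γ x φ a n) = proj₁ n ≡ x × AnnLe Φ0 a x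
  × (∀ {χ b} → (χ , b) ∈ Γ → n ∉ b)
CloValid Φ0 (disch Γ x φ a n) = ⊤

CloDerivation : Clo.Tree → List Fm → Set
CloDerivation ρ Γ =
    (∃[ Δ ] (Clo.WellFormed ρ Δ × map proj₁ Δ ≋ Γ))
  × (∀ α r → ρ α ≡ just r → CloValid Γ r)
  × (∀ α Γ' x φ a n → ρ α ≡ just (disch Γ' x φ a n) →
       ∃[ β ] (Clo.StrictPre β α × ρ β ≡ just (clo Γ' x φ a n)))
  × (∀ α β Γ₁ Γ₂ x₁ x₂ φ₁ φ₂ a₁ a₂ n → ρ α ≡ just (clo Γ₁ x₁ φ₁ a₁ n) →
       ρ β ≡ just (clo Γ₂ x₂ φ₂ a₂ n) → α ≡ β)

eraseF : AF → LF ⊤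
eraseF (φ , _) = (φ , tt)

eraseS : List AF → List (LF ⊤)
eraseS = map eraseF

eraseB : BaseR Ann → NWR
eraseB (ax p a) = ax p tt
eraseB (or Γ φ ψ a) = or (eraseS Γ) φ ψ tt
eraseB (and Γ φ ψ a) = and (eraseS Γ) φ ψ tt
eraseB (weak Γ φ a) = weak (eraseS Γ) φ tt
eraseB (box Γ φ a) = box (eraseS Γ) φ tt
eraseB (fixR Γ k x φ a) = fixR (eraseS Γ) k x φ tt

data _≈R_ : NWR → NWR → Set where
  ax   : ∀ {p} → ax p tt ≈R ax p tt
  or   : ∀ {Γ Γ' φ ψ} → Γ ≋ Γ' → or Γ φ ψ tt ≈R or Γ' φ ψ tt
  and  : ∀ {Γ Γ' φ ψ} → Γ ≋ Γ' → and Γ φ ψ tt ≈R and Γ' φ ψ tt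
  weak : ∀ {Γ Γ' φ} → Γ ≋ Γ' → weak Γ φ tt ≈R weak Γ' φ tt
  box  : ∀ {Γ Γ' φ} → Γ ≋ Γ' → box Γ φ tt ≈R box Γ' φ tt
  fixR : ∀ {Γ Γ' k x φ} → Γ ≋ Γ' → fixR Γ k x φ tt ≈R fixR Γ' k x φ tt

Corr : NW.Tree → (Addr → Addr) → Addr → CloR → Set
Corr π f α (base r) = ∃[ r' ] (π (f α) ≡ just r' × r' ≈R eraseB r)
  × (∀ b → f (α ++ [ b ]) ≡ f α ++ [ b ])
Corr π f α (clo Γ x φ a n) = ∃[ r' ] (π (f α) ≡ just r' × r' ≈R fixR (eraseS Γ) νK x φ tt)
  × (∀ b → f (α ++ [ b ]) ≡ f α ++ [ b ])
Corr π f α (exp ts) = f (α ++ [ false ]) ≡ f α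
Corr π f α (disch Γ x φ a n) = ∃[ r' ] (π (f α) ≡ just r' × NW-concEq r')
  where NW-concEq : NWR → Set
        NW-concEq r' = concB r' ≋ eraseS (concC (disch Γ x φ a n))

-- ρ is obtained from π: the non-Exp nodes of ρ correspond to nodes of π with the
-- same rule (Clo instances to ν instances, discharged assumptions to pruned nodes)
ObtainedFrom : Clo.Tree → NW.Tree → Set
ObtainedFrom ρ π = ∃[ f ] (f [] ≡ [] × (∀ α r → ρ α ≡ just r → Corr π f α r))

xV yV : Var
xV = 0
yV = 1

pP : Prop
pP = 0

φx : Fm
φx = ◇ (neg pP ∧ᶠ (□ (var xV) ∨ᶠ ◇ (fix νK yV (□ (pos pP ∧ᶠ (□ (var xV) ∨ᶠ ◇ (var yV)))))))

νxφ : Fm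
νxφ = fix νK xV φx

ψy : Fm
ψy = □ (pos pP ∧ᶠ (□ νxφ ∨ᶠ ◇ (var yV)))

νyψ : Fm
νyψ = fix νK yV ψy

Φ : List Fm
Φ = νxφ ∷ νyψ ∷ []

data IsExp : CloR → Set where
  isExp : ∀ {ts} → IsExp (exp ts)

Unfolding : Clo.Tree → Addr → Set
Unfolding ρ α = ∃[ r ] (ρ α ≡ just r × ¬ IsExp r × map proj₁ (concC r) ≋ Φ)

ChildT : Clo.Tree → Addr → Addr → Set
ChildT ρ u v = Unfolding ρ u × Unfolding ρ v × Clo.StrictPre u v
  × (∀ w → Clo.StrictPre u w → Clo.StrictPre w v → ¬ Unfolding ρ w)

NoTraceFrom : Clo.Tree → Fm → Addr → List Bool → Set
NoTraceFrom ρ χ₀ u γ = ¬ (∃[ a ] ∃[ χ ] ∃[ b ] (χ ∈ Φ × Clo.TraceFrom ρ u (χ₀ , a) γ (χ , b)))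

XNode : Clo.Tree → Addr → List Bool → Set
XNode ρ u γ = NoTraceFrom ρ νyψ u γ

YNode : Clo.Tree → Addr → List Bool → Set
YNode ρ u γ = NoTraceFrom ρ νxφ u γ

NoDischIn : Clo.Tree → Addr → Name → Set
NoDischIn ρ v n = ∀ w Γ x φ a → ρ (v ++ w) ≢ just (disch Γ x φ a n)

-- the claim for a Clo rule instance with principal formula χ₀ at a node
-- u ++ δ between u (inclusive) and v = u ++ γ (exclusive)
CloBetweenNotDischarged : Clo.Tree → Fm → Addr → List Bool → Set
CloBetweenNotDischarged ρ χ₀ u γ = ∀ δ ε Γ x φ a n → γ ≡ δ ++ ε → ε ≢ [] →
  ρ (u ++ δ) ≡ just (clo Γ x φ a n) → fix νK x φ ≡ χ₀ → NoDischIn ρ (u ++ γ) n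

-- Along a trace an annotation can only lose names, except that a Clo rule adds its own token,
-- and tokens are unique; so a discharged assumption marked 𝔵 below v is reached by a trace
-- from the principal formula of the rule at u'. Prolonged down to u, this gives a trace from
-- Φ at u through u' to Φ at v, and it cannot change between νx.φ and νy.ψ on its way to u'.
-- Indeed the closure of Φ consists of two levels, {νx.φ, ◇(p̄∧C), νy.ψ, □(p∧C)} and
-- {p̄∧C, p∧C, p̄, p, C, □νx.φ, ◇νy.ψ} with C = □νx.φ ∨ ◇νy.ψ, and every □-rule swaps them.
-- Before the first □-rule a trace stays in {νx.φ, ◇(p̄∧C)} or in {νy.ψ, □(p∧C)}; after the
-- second one the sequent is either Φ again, giving an unfolding node before u', or consists
-- of copies of νx.φ, after which only νx.φ and its unfolding occur, contradicting that v is
-- labelled Φ. So the trace starts at u with the principal formula of u', which is excluded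
-- for an x-node (principal νy.ψ) and for a y-node (principal νx.φ).
module Submission where

open import Defs
open import Data.List using (_++_)
open import Data.Product using (_×_)

open import Data.Bool using (Bool; true; false)
open import Data.Empty using (⊥; ⊥-elim)
open import Data.List using (List; []; _∷_; map; [_])
open import Data.List.Membership.Propositional using (_∈_; _∉_)
open import Data.List.Membership.Propositional.Properties using (∈-map⁺; ∈-map⁻; ∈-++⁻; ∈-++⁺ʳ)
open import Data.List.Properties using (++-assoc; ++-identityʳ; ++-identityʳ-unique; ++-conicalˡ; ++-conicalʳ; map-∘)
import Data.List.Relation.Binary.Sublist.Propositional as Sublist
open import Data.List.Relation.Binary.Subset.Propositional.Properties using (⊆-trans; ⊆-reflexive; map⁺)
import Data.List.Relation.Unary.All as All
open import Data.List.Relation.Unary.Any using (here; there)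
open import Data.Maybe using (Maybe; just)
open import Data.Maybe.Properties using (just-injective)
open import Data.Product using (∃-syntax; _,_; proj₁; proj₂)
open import Data.Sum using (_⊎_; inj₁; inj₂; [_,_]′)
import Data.Sum as Sum
open import Function using (_∘_)
open import Relation.Nullary using (¬_)
open import Relation.Binary.PropositionalEquality using (_≡_; _≢_; refl; sym; trans; cong; subst; module ≡-Reasoning)

private variable
  α β γ δ ε : Addr
  b : Bool

infix 4 _≼_ _≺_

_≼_ : Addr → Addr → Set
α ≼ β = ∃[ δ ] (α ++ δ ≡ β)

_≺_ : Addr → Addr → Set
_≺_ = Clo.StrictPre

≼-refl : α ≼ α
≼-refl {α = α} = [] , ++-identityʳ α

≼-++ : ∀ α γ → α ≼ α ++ γ
≼-++ α γ = γ , refl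

≼-trans : α ≼ β → β ≼ γ → α ≼ γ
≼-trans {α = α} (δ , refl) (ε , refl) = δ ++ ε , sym (++-assoc α δ ε)

≺-≼-trans : α ≺ β → β ≼ γ → α ≺ γ
≺-≼-trans {α = α} (δ , δ≢[] , refl) (ε , refl) =
  δ ++ ε , δ≢[] ∘ ++-conicalˡ δ ε , sym (++-assoc α δ ε)

≼-≺-trans : α ≼ β → β ≺ γ → α ≺ γ
≼-≺-trans {α = α} (δ , refl) (ε , ε≢[] , refl) =
  δ ++ ε , ε≢[] ∘ ++-conicalʳ δ ε , sym (++-assoc α δ ε)

≺-child : α ≺ α ++ [ b ]
≺-child {b = b} = [ b ] , (λ ()) , refl

≺-irrefl : ¬ α ≺ α
≺-irrefl {α = α} (δ , δ≢[] , eq) = δ≢[] (++-identityʳ-unique α (sym eq))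

twoValued : ∀ {A B : Set} (f : A → B) {a c : B} xs → (∀ {x} → x ∈ xs → f x ∈ a ∷ c ∷ []) →
  c ∈ map f xs ⊎ (∀ {x} → x ∈ xs → f x ≡ a)
twoValued f [] _ = inj₂ (λ ())
twoValued f (x ∷ xs) inAC with inAC (here refl) | twoValued f xs (inAC ∘ there)
... | there (here fx≡c) | _ = inj₁ (here (sym fx≡c))
... | here _ | inj₁ c∈ = inj₁ (there c∈)
... | here fx≡a | inj₂ allA = inj₂ λ { (here refl) → fx≡a ; (there x∈) → allA x∈ }

≋-trans : ∀ {A : Set} {xs ys zs : List A} → xs ≋ ys → ys ≋ zs → xs ≋ zs
≋-trans (p₁ , q₁) (p₂ , q₂) = ⊆-trans p₁ p₂ , ⊆-trans q₂ q₁

module TreeFacts {I F : Set} (conc : I → List F) (prem : I → Bool → Maybe (List F))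
  (desc : I → Bool → F → F → Set)
  (ancestor : ∀ r b {Δ θ'} → prem r b ≡ just Δ → θ' ∈ Δ → ∃[ θ ] (θ ∈ conc r × desc r b θ θ'))
  where

  open Trees conc prem desc

  Every : (F → Set) → I → Set
  Every P r = ∀ {θ} → θ ∈ conc r → P θ

  everyPremise : ∀ {Q : F → Set} {r b Δ r'} → (∀ {θ θ'} → θ ∈ conc r → desc r b θ θ' → Q θ') →
    prem r b ≡ just Δ → conc r' ≋ Δ → Every Q r'
  everyPremise H p q m with ancestor _ _ p (proj₁ q m)
  ... | _ , θ∈ , d = H θ∈ d

  module OnTree (t : Tree) (wf : ∀ α b → ChildOK (t α) b (t (α ++ [ b ]))) where

    EveryAt : (F → Set) → Addr → Set
    EveryAt P α = ∀ {r} → t α ≡ just r → Every P r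

    sameNode : ∀ {r} → α ≡ β → t α ≡ just r → t β ≡ just r
    sameNode {r = r} eq = subst (λ w → t w ≡ just r) eq

    everyAt : ∀ {P r} → t α ≡ just r → Every P r → EveryAt P α
    everyAt {P = P} e A e' = subst (Every P) (just-injective (trans (sym e) e')) A

    parentNode : ∀ {r'} → t (α ++ [ b ]) ≡ just r' →
      ∃[ r ] ∃[ Δ ] (t α ≡ just r × prem r b ≡ just Δ × conc r' ≋ Δ)
    parentNode {α = α} {b = b} e' = fromChildOK (subst (ChildOK (t α) b) e' (wf α b))
      where
        fromChildOK : ∀ {m r'} → ChildOK m b (just r') →
          ∃[ r ] ∃[ Δ ] (m ≡ just r × prem r b ≡ just Δ × conc r' ≋ Δ)
        fromChildOK (some p q) = _ , _ , refl , p , q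

    premiseOf : ∀ {r r'} → t α ≡ just r → t (α ++ [ b ]) ≡ just r' →
      ∃[ Δ ] (prem r b ≡ just Δ × conc r' ≋ Δ)
    premiseOf e e' with parentNode e'
    ... | _ , Δ , e₀ , p , q with just-injective (trans (sym e) e₀)
    ...   | refl = Δ , p , q

    prefixNode : ∀ γ {r} → t (α ++ γ) ≡ just r → ∃[ r₀ ] (t α ≡ just r₀)
    prefixNode {α = α} [] e = _ , sameNode (++-identityʳ α) e
    prefixNode {α = α} (b ∷ γ) e with prefixNode γ (sameNode (sym (++-assoc α [ b ] γ)) e)
    ... | _ , e₁ with parentNode e₁
    ...   | r , _ , e₀ , _ = r , e₀

    everyAtChild : ∀ {Q r} → t α ≡ just r → (∀ {θ θ'} → θ ∈ conc r → desc r b θ θ' → Q θ') →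
      EveryAt Q (α ++ [ b ])
    everyAtChild e H e' with premiseOf e e'
    ... | _ , p , q = everyPremise H p q

    invariantBelow : ∀ {P} → (∀ r {b θ θ'} → Every P r → θ ∈ conc r → desc r b θ θ' → P θ') →
      ∀ γ → EveryAt P α → EveryAt P (α ++ γ)
    invariantBelow {α = α} {P = P} closed [] A = subst (EveryAt P) (sym (++-identityʳ α)) A
    invariantBelow {α = α} {P = P} closed (b ∷ γ) A =
      subst (EveryAt P) (++-assoc α [ b ] γ) (invariantBelow closed γ atChild)
      where
        atChild : EveryAt P (α ++ [ b ])
        atChild e' with parentNode e'
        ... | r , _ , e , _ = everyAtChild e (closed r (A e)) e'

    traceStart : ∀ {θ θ'} → TraceFrom t α θ γ θ' → ∃[ r ] (t α ≡ just r × θ ∈ conc r)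
    traceStart (here e m) = _ , e , m
    traceStart (step e m _ _) = _ , e , m

    traceEnd : ∀ {θ θ'} → TraceFrom t α θ γ θ' → ∃[ r ] (t (α ++ γ) ≡ just r × θ' ∈ conc r)
    traceEnd {α = α} (here e m) = _ , sameNode (sym (++-identityʳ α)) e , m
    traceEnd {α = α} (step {b = b} {γ = γ} _ _ _ rest) with traceEnd rest
    ... | r , e , m = r , sameNode (++-assoc α [ b ] γ) e , m

    trace-++ : ∀ {θ θ' θ''} → TraceFrom t α θ γ θ' → TraceFrom t (α ++ γ) θ' δ θ'' →
      TraceFrom t α θ (γ ++ δ) θ''
    trace-++ {α = α} (here _ _) tr = subst (λ w → TraceFrom t w _ _ _) (++-identityʳ α) tr
    trace-++ {α = α} (step {b = b} {γ = γ} e m d rest) tr =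
      step e m d (trace-++ rest (subst (λ w → TraceFrom t w _ _ _) (sym (++-assoc α [ b ] γ)) tr))

    trace-split : ∀ γ {θ θ''} → TraceFrom t α θ (γ ++ δ) θ'' →
      ∃[ θ' ] (TraceFrom t α θ γ θ' × TraceFrom t (α ++ γ) θ' δ θ'')
    trace-split {α = α} [] tr with traceStart tr
    ... | _ , e , m = _ , here e m , subst (λ w → TraceFrom t w _ _ _) (sym (++-identityʳ α)) tr
    trace-split {α = α} (b ∷ γ) (step e m d rest) with trace-split γ rest
    ... | θ' , front , back =
      θ' , step e m d front , subst (λ w → TraceFrom t w _ _ _) (++-assoc α [ b ] γ) back

    ancestorTrace : ∀ γ {r θ'} → t (α ++ γ) ≡ just r → θ' ∈ conc r → ∃[ θ ] TraceFrom t α θ γ θ'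
    ancestorTrace {α = α} [] e m = _ , here (sameNode (++-identityʳ α) e) m
    ancestorTrace {α = α} (b ∷ γ) e m with ancestorTrace γ (sameNode (sym (++-assoc α [ b ] γ)) e) m
    ... | _ , tr with traceStart tr
    ...   | _ , e₁ , m₁ with parentNode e₁
    ...     | r , _ , e₀ , p , q with ancestor r b p (proj₁ q m₁)
    ...       | θ , θ∈ , d = θ , step e₀ θ∈ d tr

cloAncestor : ∀ r b {Δ θ'} → premC r b ≡ just Δ → θ' ∈ Δ → ∃[ θ ] (θ ∈ concC r × descC r b θ θ')
cloAncestor (base (ax _ _)) _ () _
cloAncestor (base (or _ _ _ _)) false refl (here refl) = _ , here refl , inj₂ (refl , inj₁ refl)
cloAncestor (base (or _ _ _ _)) false refl (there (here refl)) = _ , here refl , inj₂ (refl , inj₂ refl)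
cloAncestor (base (or _ _ _ _)) false refl (there (there m)) = _ , there m , inj₁ (m , refl)
cloAncestor (base (or _ _ _ _)) true () _
cloAncestor (base (and _ _ _ _)) false refl (here refl) = _ , here refl , inj₂ (refl , refl)
cloAncestor (base (and _ _ _ _)) false refl (there m) = _ , there m , inj₁ (m , refl)
cloAncestor (base (and _ _ _ _)) true refl (here refl) = _ , here refl , inj₂ (refl , refl)
cloAncestor (base (and _ _ _ _)) true refl (there m) = _ , there m , inj₁ (m , refl)
cloAncestor (base (weak _ _ _)) false refl m = _ , there m , (m , refl)
cloAncestor (base (weak _ _ _)) true () _
cloAncestor (base (box _ _ _)) false refl (here refl) = _ , here refl , inj₁ (refl , refl)
cloAncestor (base (box _ _ _)) false refl (there m) = _ , there (∈-map⁺ diaL m) , inj₂ (m , refl)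
cloAncestor (base (box _ _ _)) true () _
cloAncestor (base (fixR _ _ _ _ _)) false refl (here refl) = _ , here refl , inj₂ (refl , refl)
cloAncestor (base (fixR _ _ _ _ _)) false refl (there m) = _ , there m , inj₁ (m , refl)
cloAncestor (base (fixR _ _ _ _ _)) true () _
cloAncestor (exp ts) false refl m with ∈-map⁻ _ m
... | (φ , a , c) , t∈ , refl = _ , ∈-map⁺ _ t∈ , (φ , a , c , t∈ , refl , refl)
cloAncestor (exp _) true () _
cloAncestor (clo _ _ _ _ _) false refl (here refl) = _ , here refl , inj₂ (refl , refl)
cloAncestor (clo _ _ _ _ _) false refl (there m) = _ , there m , inj₁ (m , refl)
cloAncestor (clo _ _ _ _ _) true () _
cloAncestor (disch _ _ _ _ _) _ () _

open TreeFacts concC premC descC cloAncestor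

childrenOK : ∀ {ρ Γ₀} → CloDerivation ρ Γ₀ → ∀ α b → Clo.ChildOK (ρ α) b (ρ (α ++ [ b ]))
childrenOK cd = proj₂ (proj₁ (proj₂ (proj₁ cd)))

rulesValid : ∀ {ρ Γ₀} → CloDerivation ρ Γ₀ → ∀ α r → ρ α ≡ just r → CloValid Γ₀ r
rulesValid cd = proj₁ (proj₂ cd)

tokensUnique : ∀ {ρ Γ₀ Γ₁ Γ₂ x₁ x₂ φ₁ φ₂ a₁ a₂ n} → CloDerivation ρ Γ₀ →
  ρ α ≡ just (clo Γ₁ x₁ φ₁ a₁ n) → ρ β ≡ just (clo Γ₂ x₂ φ₂ a₂ n) → α ≡ β
tokensUnique cd = proj₂ (proj₂ (proj₂ cd)) _ _ _ _ _ _ _ _ _ _ _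

labels : CloR → List Fm
labels r = map proj₁ (concC r)

data IsBox : CloR → Set where
  isBox : ∀ {Γ φ l} → IsBox (base (box Γ φ l))

boxOrNot : ∀ r → IsBox r ⊎ ¬ IsBox r
boxOrNot (base (box _ _ _)) = inj₁ isBox
boxOrNot (base (ax _ _)) = inj₂ λ ()
boxOrNot (base (or _ _ _ _)) = inj₂ λ ()
boxOrNot (base (and _ _ _ _)) = inj₂ λ ()
boxOrNot (base (weak _ _ _)) = inj₂ λ ()
boxOrNot (base (fixR _ _ _ _ _)) = inj₂ λ ()
boxOrNot (exp _) = inj₂ λ ()
boxOrNot (clo _ _ _ _ _) = inj₂ λ ()
boxOrNot (disch _ _ _ _ _) = inj₂ λ ()

expOrNot : ∀ r → IsExp r ⊎ ¬ IsExp r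
expOrNot (exp _) = inj₁ isExp
expOrNot (base _) = inj₂ λ ()
expOrNot (clo _ _ _ _ _) = inj₂ λ ()
expOrNot (disch _ _ _ _ _) = inj₂ λ ()

data Step : Fm → Fm → Set where
  keep      : ∀ {φ} → Step φ φ
  ∨ˡ        : ∀ {φ ψ} → Step (φ ∨ᶠ ψ) φ
  ∨ʳ        : ∀ {φ ψ} → Step (φ ∨ᶠ ψ) ψ
  ∧ˡ        : ∀ {φ ψ} → Step (φ ∧ᶠ ψ) φ
  ∧ʳ        : ∀ {φ ψ} → Step (φ ∧ᶠ ψ) ψ
  unfolds : ∀ {k x φ} → Step (fix k x φ) (unfold k x φ)

data Unbox : Fm → Fm → Set where
  □⁻ : ∀ {φ} → Unbox (□ φ) φ
  ◇⁻ : ∀ {φ} → Unbox (◇ φ) φ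

nonBoxStep : ∀ r {b θ θ'} → ¬ IsBox r → descC r b θ θ' → Step (proj₁ θ) (proj₁ θ')
nonBoxStep (base (ax _ _)) _ ()
nonBoxStep (base (or _ _ _ _)) _ (inj₁ (_ , refl)) = keep
nonBoxStep (base (or _ _ _ _)) _ (inj₂ (refl , inj₁ refl)) = ∨ˡ
nonBoxStep (base (or _ _ _ _)) _ (inj₂ (refl , inj₂ refl)) = ∨ʳ
nonBoxStep (base (and _ _ _ _)) {false} _ (inj₁ (_ , refl)) = keep
nonBoxStep (base (and _ _ _ _)) {true} _ (inj₁ (_ , refl)) = keep
nonBoxStep (base (and _ _ _ _)) {false} _ (inj₂ (refl , refl)) = ∧ˡ
nonBoxStep (base (and _ _ _ _)) {true} _ (inj₂ (refl , refl)) = ∧ʳ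
nonBoxStep (base (weak _ _ _)) _ (_ , refl) = keep
nonBoxStep (base (box _ _ _)) notBox _ = ⊥-elim (notBox isBox)
nonBoxStep (base (fixR _ _ _ _ _)) _ (inj₁ (_ , refl)) = keep
nonBoxStep (base (fixR _ _ _ _ _)) _ (inj₂ (refl , refl)) = unfolds
nonBoxStep (exp _) _ (_ , _ , _ , _ , refl , refl) = keep
nonBoxStep (clo _ _ _ _ _) _ (inj₁ (_ , refl)) = keep
nonBoxStep (clo _ _ _ _ _) _ (inj₂ (refl , refl)) = unfolds
nonBoxStep (disch _ _ _ _ _) _ ()

boxStep : ∀ Γ φ l {b θ θ'} → descC (base (box Γ φ l)) b θ θ' → Unbox (proj₁ θ) (proj₁ θ')
boxStep _ _ _ (inj₁ (refl , refl)) = □⁻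
boxStep _ _ _ (inj₂ (_ , refl)) = ◇⁻

baseAnnotation : ∀ {L} (r : BaseR L) {b θ θ'} → descB r b θ θ' → proj₂ θ' ≡ proj₂ θ
baseAnnotation (ax _ _) ()
baseAnnotation (or _ _ _ _) (inj₁ (_ , refl)) = refl
baseAnnotation (or _ _ _ _) (inj₂ (refl , inj₁ refl)) = refl
baseAnnotation (or _ _ _ _) (inj₂ (refl , inj₂ refl)) = refl
baseAnnotation (and _ _ _ _) {b = false} (inj₁ (_ , refl)) = refl
baseAnnotation (and _ _ _ _) {b = true} (inj₁ (_ , refl)) = refl
baseAnnotation (and _ _ _ _) {b = false} (inj₂ (refl , refl)) = refl
baseAnnotation (and _ _ _ _) {b = true} (inj₂ (refl , refl)) = refl
baseAnnotation (weak _ _ _) (_ , refl) = refl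
baseAnnotation (box _ _ _) (inj₁ (refl , refl)) = refl
baseAnnotation (box _ _ _) (inj₂ (_ , refl)) = refl
baseAnnotation (fixR _ _ _ _ _) (inj₁ (_ , refl)) = refl
baseAnnotation (fixR _ _ _ _ _) (inj₂ (refl , refl)) = refl

IntroducesToken : Name → CloR → Set
IntroducesToken n r = ∃[ Γ ] ∃[ x ] ∃[ φ ] ∃[ a ] (r ≡ clo Γ x φ a n)

tokenOrigin : ∀ {Φ₀} r {θ θ' n} → CloValid Φ₀ r → descC r b θ θ' → n ∈ proj₂ θ' →
  n ∈ proj₂ θ ⊎ IntroducesToken n r
tokenOrigin (base r) _ d n∈ = inj₁ (subst (_ ∈_) (baseAnnotation r d) n∈)
tokenOrigin (exp _) valid (_ , _ , _ , t∈ , refl , refl) n∈ = inj₁ (Sublist.lookup (All.lookup valid t∈) n∈)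
tokenOrigin (clo _ _ _ _ _) _ (inj₁ (_ , refl)) n∈ = inj₁ n∈
tokenOrigin (clo _ _ _ a _) _ (inj₂ (refl , refl)) n∈ with ∈-++⁻ a n∈
... | inj₁ n∈a = inj₁ n∈a
... | inj₂ (here refl) = inj₂ (_ , _ , _ , _ , refl)
tokenOrigin (disch _ _ _ _ _) _ () _

expPremiseLabels : ∀ ts {Δ} → premC (exp ts) b ≡ just Δ → map proj₁ Δ ≡ labels (exp ts)
expPremiseLabels {false} ts refl = trans (sym (map-∘ ts)) (map-∘ ts)
expPremiseLabels {true} ts ()

expChildLabels : ∀ ts {b Δ r'} → premC (exp ts) b ≡ just Δ → concC r' ≋ Δ → labels r' ≋ labels (exp ts)
expChildLabels ts {b} p (r'⊆Δ , Δ⊆r') =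
  ⊆-trans (map⁺ proj₁ r'⊆Δ) (⊆-reflexive (expPremiseLabels {b} ts p)) ,
  ⊆-trans (⊆-reflexive (sym (expPremiseLabels {b} ts p))) (map⁺ proj₁ Δ⊆r')

module Tokens {Γ₀ ρ} (cd : CloDerivation ρ Γ₀) {u' Γ x φ a n} (hu : ρ u' ≡ just (clo Γ x φ a n)) where
  open OnTree ρ (childrenOK cd)

  tokenAbsent : ∀ {θ θ'} → u' ≺ α → Clo.TraceFrom ρ α θ γ θ' → n ∉ proj₂ θ → n ∉ proj₂ θ'
  tokenAbsent _ (Clo.here _ _) n∉ = n∉
  tokenAbsent {α = α} u'≺α (Clo.step {r = r} {b = b} e _ d rest) n∉ =
    tokenAbsent (≺-≼-trans u'≺α (≼-++ α [ b ])) rest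
      (λ n∈ → [ n∉ , notCompanion ]′ (tokenOrigin r (rulesValid cd α r e) d n∈))
    where
      notCompanion : ¬ IntroducesToken n r
      notCompanion (_ , _ , _ , _ , r≡) =
        ≺-irrefl (subst (u' ≺_) (tokensUnique cd (trans e (cong just r≡)) hu) u'≺α)

  dischargeTrace : ∀ η {Γ' x' φ' a'} → ρ (u' ++ η) ≡ just (disch Γ' x' φ' a' n) →
    Clo.TraceFrom ρ u' (fix νK x φ , a) η (fix νK x' φ' , a' ++ [ n ])
  dischargeTrace η hd with ancestorTrace η hd (here refl)
  ... | _ , Clo.here e _ with trans (sym hu) (sameNode (++-identityʳ u') hd)
  ...   | ()
  dischargeTrace η {a' = a'} hd | _ , tr@(Clo.step e _ d rest) with just-injective (trans (sym hu) e) | d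
  ... | refl | inj₂ (refl , _) = tr
  ... | refl | inj₁ (θ∈Γ , refl) =
    ⊥-elim (tokenAbsent ≺-child rest (proj₂ (proj₂ (rulesValid cd u' _ hu)) θ∈Γ) (∈-++⁺ʳ a' (here refl)))

C : Fm
C = □ νxφ ∨ᶠ ◇ νyψ

data XFm : Fm → Set where
  [νx]     : XFm νxφ
  [◇p̄∧C] : XFm (◇ (neg pP ∧ᶠ C))

data YFm : Fm → Set where
  [νy]    : YFm νyψ
  [□p∧C] : YFm (□ (pos pP ∧ᶠ C))

Level0 : Fm → Set
Level0 φ = XFm φ ⊎ YFm φ

data Level1 : Fm → Set where
  [p̄∧C] : Level1 (neg pP ∧ᶠ C)
  [p∧C]  : Level1 (pos pP ∧ᶠ C)
  [p̄]    : Level1 (neg pP)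
  [p]     : Level1 (pos pP)
  [C]     : Level1 C
  [□νx]   : Level1 (□ νxφ)
  [◇νy]   : Level1 (◇ νyψ)

xfm-step : ∀ {φ ψ} → Step φ ψ → XFm φ → XFm ψ
xfm-step keep X = X
xfm-step unfolds [νx] = [◇p̄∧C]
xfm-step ∨ˡ ()
xfm-step ∨ʳ ()
xfm-step ∧ˡ ()
xfm-step ∧ʳ ()

yfm-step : ∀ {φ ψ} → Step φ ψ → YFm φ → YFm ψ
yfm-step keep Y = Y
yfm-step unfolds [νy] = [□p∧C]
yfm-step ∨ˡ ()
yfm-step ∨ʳ ()
yfm-step ∧ˡ ()
yfm-step ∧ʳ ()

level0-step : ∀ {φ ψ} → Step φ ψ → Level0 φ → Level0 ψ
level0-step s = Sum.map (xfm-step s) (yfm-step s)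

level1-step : ∀ {φ ψ} → Step φ ψ → Level1 φ → Level1 ψ
level1-step keep L = L
level1-step ∧ˡ [p̄∧C] = [p̄]
level1-step ∧ʳ [p̄∧C] = [C]
level1-step ∧ˡ [p∧C] = [p]
level1-step ∧ʳ [p∧C] = [C]
level1-step ∨ˡ [C] = [□νx]
level1-step ∨ʳ [C] = [◇νy]
level1-step unfolds ()

level0-unbox : ∀ {φ ψ} → Unbox φ ψ → Level0 φ → Level1 ψ
level0-unbox □⁻ (inj₂ [□p∧C]) = [p∧C]
level0-unbox ◇⁻ (inj₁ [◇p̄∧C]) = [p̄∧C]
level0-unbox □⁻ (inj₁ ())
level0-unbox ◇⁻ (inj₂ ())

level1-unbox : ∀ {φ ψ} → Unbox φ ψ → Level1 φ → ψ ∈ Φ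
level1-unbox □⁻ [□νx] = here refl
level1-unbox ◇⁻ [◇νy] = there (here refl)

Φ⊆Level0 : ∀ {φ} → φ ∈ Φ → Level0 φ
Φ⊆Level0 (here refl) = inj₁ [νx]
Φ⊆Level0 (there (here refl)) = inj₂ [νy]

Φ∩Level1 : ∀ {φ} → φ ∈ Φ → ¬ Level1 φ
Φ∩Level1 (here refl) ()
Φ∩Level1 (there (here refl)) ()

xfmClosed : ∀ r {b θ θ'} → Every (XFm ∘ proj₁) r → θ ∈ concC r → descC r b θ θ' → XFm (proj₁ θ')
xfmClosed r X θ∈ d with boxOrNot r
... | inj₂ notBox = xfm-step (nonBoxStep r notBox d) (X θ∈)
... | inj₁ isBox with X (here refl)
...   | ()

module InDerivation (ρ : Clo.Tree) (wf : ∀ α b → Clo.ChildOK (ρ α) b (ρ (α ++ [ b ]))) where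
  open OnTree ρ wf public

  unfoldingInΦ : Unfolding ρ α → EveryAt ((_∈ Φ) ∘ proj₁) α
  unfoldingInΦ (_ , e , _ , Φ≋) = everyAt e (λ θ∈ → proj₁ Φ≋ (∈-map⁺ proj₁ θ∈))

  XLocked : Addr → Set
  XLocked = EveryAt (XFm ∘ proj₁)

  xLockedBelow : ∀ γ → XLocked α → XLocked (α ++ γ)
  xLockedBelow = invariantBelow xfmClosed

  unfoldingNotXLocked : Unfolding ρ α → ¬ XLocked α
  unfoldingNotXLocked (_ , e , _ , Φ≋) X with ∈-map⁻ proj₁ (proj₂ Φ≋ (there (here refl)))
  ... | _ , θ∈ , νy≡ with subst XFm (sym νy≡) (X e θ∈)
  ...   | ()

  unfoldingBetween : ∀ γ {r r'} → ρ α ≡ just r → labels r ≋ Φ → ρ (α ++ γ) ≡ just r' → ¬ IsExp r' →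
    ∃[ w ] (α ≼ w × w ≼ α ++ γ × Unfolding ρ w)
  unfoldingBetween {α = α} γ {r} e Φ≋ _ _ with expOrNot r
  ... | inj₂ notExp = α , ≼-refl , ≼-++ α γ , (r , e , notExp , Φ≋)
  unfoldingBetween {α = α} [] e _ e' notExp | inj₁ isExp
    with just-injective (trans (sym e) (sameNode (++-identityʳ α) e'))
  ... | refl = ⊥-elim (notExp isExp)
  unfoldingBetween {α = α} (b ∷ γ) e Φ≋ e' notExp | inj₁ (isExp {ts})
    with prefixNode γ (sameNode (sym (++-assoc α [ b ] γ)) e')
  ... | r₁ , e₁ with premiseOf {b = b} e e₁
  ...   | _ , p , q with unfoldingBetween γ e₁ (≋-trans (expChildLabels ts {b} {r' = r₁} p q) Φ≋)
                          (sameNode (sym (++-assoc α [ b ] γ)) e') notExp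
  ...     | w , α[b]≼w , w≼ , unf =
    w , ≼-trans (≼-++ α [ b ]) α[b]≼w , subst (w ≼_) (++-assoc α [ b ] γ) w≼ , unf

  module Edge {u v : Addr} (edge : ChildT ρ u v) {ω rω} (ω≺v : ω ≺ v) (eω : ρ ω ≡ just rω)
    (ω-notExp : ¬ IsExp rω) where

    shift : α ++ (b ∷ γ) ≡ ω → (α ++ [ b ]) ++ γ ≡ ω
    shift {α = α} {b = b} {γ = γ} = trans (++-assoc α [ b ] γ)

    xLockedFromΦ : ∀ γ {r} → u ≺ α → ρ α ≡ just r → Every ((_∈ Φ) ∘ proj₁) r → νxφ ∈ labels r →
      α ++ γ ≡ ω → XLocked ω
    xLockedFromΦ {α = α} γ {r} u≺α e inΦ νx∈ eq with twoValued proj₁ (concC r) inΦ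
    ... | inj₂ allνx =
      subst XLocked eq (xLockedBelow γ (everyAt e (λ θ∈ → subst XFm (sym (allνx θ∈)) [νx])))
    ... | inj₁ νy∈ with unfoldingBetween γ e (⊆Φ , Φ⊆) (sameNode (sym eq) eω) ω-notExp
      where
        ⊆Φ : ∀ {φ} → φ ∈ labels r → φ ∈ Φ
        ⊆Φ φ∈ with ∈-map⁻ proj₁ φ∈
        ... | _ , θ∈ , refl = inΦ θ∈
        Φ⊆ : ∀ {φ} → φ ∈ Φ → φ ∈ labels r
        Φ⊆ (here refl) = νx∈
        Φ⊆ (there (here refl)) = νy∈
    ...   | w , α≼w , w≼ω , unf =
      ⊥-elim (proj₂ (proj₂ (proj₂ edge)) w (≺-≼-trans u≺α α≼w)
        (≼-≺-trans (subst (w ≼_) eq w≼ω) ω≺v) unf)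

    xLockedFromLevel1 : ∀ {θ χ l} → u ≺ α → Clo.TraceFrom ρ α θ γ (χ , l) → χ ∈ Φ →
      EveryAt (Level1 ∘ proj₁) α → α ++ γ ≡ ω → XLocked ω
    xLockedFromLevel1 _ (Clo.here e m) χ∈Φ L _ = ⊥-elim (Φ∩Level1 χ∈Φ (L e m))
    xLockedFromLevel1 {α = α} u≺α (Clo.step {r = r} {b = b} {γ = γ} e _ d rest) χ∈Φ L eq with boxOrNot r
    ... | inj₂ notBox =
      xLockedFromLevel1 (≺-≼-trans u≺α (≼-++ α [ b ])) rest χ∈Φ
        (everyAtChild {b = b} e (λ θ∈ d' → level1-step (nonBoxStep r notBox d') (L e θ∈))) (shift eq)
    ... | inj₁ (isBox {Γ} {φ} {l}) with traceStart rest | L e (here refl)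
    ...   | r' , e' , _ | [□νx] =
      xLockedFromΦ γ (≺-≼-trans u≺α (≼-++ α [ b ])) e'
        (everyAtChild {b = b} e (λ θ∈ d' → level1-unbox (boxStep Γ φ l {b} d') (L e θ∈)) e')
        (boxPremise b (premiseOf e e')) (shift eq)
      where
        boxPremise : ∀ b → ∃[ Δ ] (premC r b ≡ just Δ × concC r' ≋ Δ) → νxφ ∈ labels r'
        boxPremise false (_ , refl , q) = ∈-map⁺ proj₁ (proj₂ q (here refl))
        boxPremise true (_ , () , _)

    xLockedFromLevel0 : ∀ {Cls : Fm → Set} → (∀ {φ ψ} → Step φ ψ → Cls φ → Cls ψ) →
      ∀ {θ χ l} → u ≼ α → Clo.TraceFrom ρ α θ γ (χ , l) → Cls (proj₁ θ) → ¬ Cls χ → χ ∈ Φ →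
      EveryAt (Level0 ∘ proj₁) α → α ++ γ ≡ ω → XLocked ω
    xLockedFromLevel0 _ _ (Clo.here _ _) c ¬c _ _ _ = ⊥-elim (¬c c)
    xLockedFromLevel0 {α = α} cls-step u≼α (Clo.step {r = r} {b = b} e _ d rest) c ¬c χ∈Φ L eq with boxOrNot r
    ... | inj₂ notBox =
      xLockedFromLevel0 cls-step (≼-trans u≼α (≼-++ α [ b ])) rest (cls-step (nonBoxStep r notBox d) c) ¬c χ∈Φ
        (everyAtChild {b = b} e (λ θ∈ d' → level0-step (nonBoxStep r notBox d') (L e θ∈))) (shift eq)
    ... | inj₁ (isBox {Γ} {φ} {l}) =
      xLockedFromLevel1 (≼-≺-trans u≼α ≺-child) rest χ∈Φ
        (everyAtChild {b = b} e (λ θ∈ d' → level0-unbox (boxStep Γ φ l {b} d') (L e θ∈))) (shift eq)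

    crossing : ∀ {Cls : Fm → Set} → (∀ {φ ψ} → Step φ ψ → Cls φ → Cls ψ) →
      ∀ {δ χ a χ' l} → u ++ δ ≡ ω → Clo.TraceFrom ρ u (χ , a) δ (χ' , l) →
      Cls χ → ¬ Cls χ' → χ' ∈ Φ → ⊥
    crossing cls-step eq tr c ¬c χ'∈Φ =
      unfoldingNotXLocked (proj₁ (proj₂ edge))
        (subst XLocked (proj₂ (proj₂ ω≺v))
          (xLockedBelow (proj₁ ω≺v)
            (xLockedFromLevel0 cls-step ≼-refl tr c ¬c χ'∈Φ
              (λ e θ∈ → Φ⊆Level0 (unfoldingInΦ (proj₁ edge) e θ∈)) eq)))

    fixpointsDoNotCross : ∀ {δ χ a χ' l} → u ++ δ ≡ ω → Clo.TraceFrom ρ u (χ , a) δ (χ' , l) →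
      χ ∈ Φ → χ' ∈ Φ → χ ≡ χ'
    fixpointsDoNotCross _ _ (here refl) (here refl) = refl
    fixpointsDoNotCross _ _ (there (here refl)) (there (here refl)) = refl
    fixpointsDoNotCross eq tr (here refl) (there (here refl)) =
      ⊥-elim (crossing xfm-step eq tr [νx] (λ ()) (there (here refl)))
    fixpointsDoNotCross eq tr (there (here refl)) (here refl) =
      ⊥-elim (crossing yfm-step eq tr [νy] (λ ()) (here refl))
    fixpointsDoNotCross _ _ (there (there ())) _
    fixpointsDoNotCross _ _ _ (there (there ()))

regroup : ∀ (u δ ε w : Addr) → (u ++ (δ ++ ε)) ++ w ≡ (u ++ δ) ++ (ε ++ w)
regroup u δ ε w = begin
  (u ++ (δ ++ ε)) ++ w   ≡⟨ ++-assoc u (δ ++ ε) w ⟩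
  u ++ ((δ ++ ε) ++ w)   ≡⟨ cong (u ++_) (++-assoc δ ε w) ⟩
  u ++ (δ ++ (ε ++ w))   ≡⟨ ++-assoc u δ (ε ++ w) ⟨
  (u ++ δ) ++ (ε ++ w)   ∎
  where open ≡-Reasoning

module _ {ρ} (cd : CloDerivation ρ Φ) where
  open InDerivation ρ (childrenOK cd)

  traceThroughCompanion : ∀ {u γ δ ε Γ x φ a n w Γ' x' φ' a'} →
    ChildT ρ u (u ++ γ) → γ ≡ δ ++ ε → ε ≢ [] →
    ρ (u ++ δ) ≡ just (clo Γ x φ a n) → fix νK x φ ∈ Φ →
    ρ ((u ++ γ) ++ w) ≡ just (disch Γ' x' φ' a' n) →
    ∃[ a₀ ] ∃[ χ ] ∃[ l ] (χ ∈ Φ × Clo.TraceFrom ρ u (fix νK x φ , a₀) γ (χ , l))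
  traceThroughCompanion {u} {δ = δ} {ε} {w = w} edge refl ε≢[] hu fix∈Φ hd
    with trace-split ε (Tokens.dischargeTrace cd hu (ε ++ w) (sameNode (regroup u δ ε w) hd))
  ... | (χ , l) , toV , _ with traceEnd toV | ancestorTrace δ hu (here refl)
  ...   | _ , eV , χ∈ | (χ₀ , a₀) , toU' with traceStart toU'
  ...     | _ , eU , χ₀∈
    with Edge.fixpointsDoNotCross edge (ε , ε≢[] , ++-assoc u δ ε) hu (λ ()) refl toU'
           (unfoldingInΦ (proj₁ edge) eU χ₀∈) fix∈Φ
  ...       | refl =
    a₀ , χ , l , unfoldingInΦ (proj₁ (proj₂ edge)) (sameNode (++-assoc u δ ε) eV) χ∈ , trace-++ toU' toV

mainTheorem5 : ∀ (π : NW.Tree) (ρ : Clo.Tree) → NWProof π Φ → CloDerivation ρ Φ →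
    ObtainedFrom ρ π → ∀ u γ → ChildT ρ u (u ++ γ) →
    (XNode ρ u γ → CloBetweenNotDischarged ρ νyψ u γ)
    × (YNode ρ u γ → CloBetweenNotDischarged ρ νxφ u γ)
mainTheorem5 _ ρ _ cd _ u γ edge = between (there (here refl)) , between (here refl)
  where
    between : ∀ {χ₀} → χ₀ ∈ Φ → NoTraceFrom ρ χ₀ u γ → CloBetweenNotDischarged ρ χ₀ u γ
    between χ₀∈Φ noTrace δ ε _ _ _ _ _ γ≡ ε≢[] hu refl _ _ _ _ _ hd =
      noTrace (traceThroughCompanion cd edge γ≡ ε≢[] hu χ₀∈Φ hd)
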